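{- Let $\delta>0$ and let $G$ be a graph with $n$ vertices and at least $\left(\frac15-\delta\right)n^2$ edges. Then either (1) at least $\delta n$ vertices have degree at least $\left(\frac25+\delta\right)n$, or (2) at most $2\sqrt\delta\, n$ vertices have degree at most $\left(\frac25-2\sqrt\delta\right)n$.
   Formalization: The parameter δ ranges over the positive rationals. -}

module Defs where

open import Data.Bool using (Bool; true; false; _∧_; _∨_; T)
open import Data.Nat using (ℕ) renaming (_<ᵇ_ to _<ℕᵇ_)
open import Data.Integer using (+_)
open import Data.Fin using (Fin; toℕ)
open import Data.List using (List; length; filterᵇ; allFin; cartesianProduct)
open import Data.Product using (_×_; _,_)
open import Data.Sum using (_⊎_)
open import Data.Rational using (ℚ; _/_; _≤_; _*_; _≤ᵇ_; 0ℚ)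
open import Relation.Binary.PropositionalEquality using (_≡_)

record Graph (n : ℕ) : Set where
  field
    adj   : Fin n → Fin n → Bool
    sym   : ∀ i j → adj i j ≡ adj j i
    irrfl : ∀ i → adj i i ≡ false
open Graph public

ℕ→ℚ : ℕ → ℚ
ℕ→ℚ k = + k / 1

degree : ∀ {n} → Graph n → Fin n → ℕ
degree {n} G i = length (filterᵇ (adj G i) (allFin n))

edgeCount : ∀ {n} → Graph n → ℕ
edgeCount {n} G =
  length (filterᵇ (λ { (i , j) → (toℕ i <ℕᵇ toℕ j) ∧ adj G i j })
                  (cartesianProduct (allFin n) (allFin n)))

countV : ∀ {n} → (Fin n → Bool) → ℕ
countV {n} p = length (filterᵇ p (allFin n))

-- Comparisons with square roots of a rational q ≥ 0 (q = 4 δ n² below):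
-- "x ≤ √q"  iff  x ≤ 0 or x² ≤ q
_≤√_ : ℚ → ℚ → Set
x ≤√ q = x ≤ 0ℚ ⊎ x * x ≤ q

√_≤ᵇ_ : ℚ → ℚ → Bool
√ q ≤ᵇ x = (0ℚ ≤ᵇ x) ∧ (q ≤ᵇ x * x)

-- Write N = n, d(v) for degrees, q = 4δN² (so √q = 2√δ·N), and call v "low" when its
-- deficit x(v) = (2/5)N - d(v) is at least √q.  Raising the degree of every low vertex to (2/5)N
-- gives d(v) + [v low]·x(v) ≤ (2/5 + δ)N + [v high]·N for every vertex.  Summing, with the
-- handshake bound 2|E| ≤ Σ d(v), the edge hypothesis and fewer than δN high vertices, the total
-- low deficit S = Σ_{v low} x(v) satisfies S ≤ q.  Each low deficit is ≥ √q, so L·√q ≤ S for the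
-- number L of low vertices; without square roots this reads L²q ≤ S² ≤ q², i.e. L² ≤ q.
module Submission where

open import Data.Bool using (Bool; true; false; _∧_; T; if_then_else_)
open import Data.Bool.Properties using (T-∧)
open import Data.Empty using (⊥; ⊥-elim)
open import Data.Fin using (Fin; toℕ)
open import Data.Integer as ℤ using (+_)
import Data.Integer.Properties as ℤ
open import Data.List using (List; []; _∷_; _++_; map; length; filterᵇ; allFin; cartesianProduct)
import Data.List.Properties as List
open import Data.Nat as ℕ using (ℕ; zero; suc)
import Data.Nat.Coprimality as Coprimality
import Data.Nat.Properties as ℕ
open import Data.Product using (_×_; _,_; proj₁; proj₂)
import Data.Product as Product
open import Data.Rational
open import Data.Rational.Properties
open import Data.Rational.Solver using (module +-*-Solver)
open import Data.Sum using (_⊎_; inj₁; inj₂)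
open import Function using (_∘_; Equivalence)
open import Relation.Binary.PropositionalEquality
open import Relation.Nullary using (Dec; yes; no)
open import Relation.Nullary.Decidable using (T?)
open import Defs hiding (sym)

open +-*-Solver using (solve; _:=_; _:+_; _:*_; :-_; _:-_; con)

ℕ→ℚ-mkℚ : ∀ k → ℕ→ℚ k ≡ mkℚ (+ k) 0 (Coprimality.sym (Coprimality.1-coprimeTo k))
ℕ→ℚ-mkℚ k = normalize-coprime (Coprimality.sym (Coprimality.1-coprimeTo k))

ℕ→ℚ-suc : ∀ k → ℕ→ℚ (suc k) ≡ 1ℚ + ℕ→ℚ k
ℕ→ℚ-suc k rewrite ℕ→ℚ-mkℚ k =
  /-cong {p₁ = + suc k} {q₁ = 1} {p₂ = + 1 ℤ.* + 1 ℤ.+ + k ℤ.* + 1} {q₂ = 1}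
         (cong (λ z → + 1 ℤ.+ z) (sym (ℤ.*-identityʳ (+ k)))) refl

ℕ→ℚ-mono : ∀ a b → a ℕ.≤ b → ℕ→ℚ a ≤ ℕ→ℚ b
ℕ→ℚ-mono a b a≤b rewrite ℕ→ℚ-mkℚ a | ℕ→ℚ-mkℚ b =
  *≤* (subst₂ ℤ._≤_ (sym (ℤ.*-identityʳ (+ a))) (sym (ℤ.*-identityʳ (+ b))) (ℤ.+≤+ a≤b))

ℕ→ℚ-nonneg : ∀ k → 0ℚ ≤ ℕ→ℚ k
ℕ→ℚ-nonneg k = ℕ→ℚ-mono 0 k ℕ.z≤n

ℕ→ℚ-pos : ∀ k → 0ℚ < ℕ→ℚ (suc k)
ℕ→ℚ-pos k = positive⁻¹ (ℕ→ℚ (suc k)) {{normalize-pos (suc k) 1}}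

≤-+-nonneg : ∀ {u t} → 0ℚ ≤ t → u ≤ u + t
≤-+-nonneg {u} {t} t≥0 = subst (_≤ u + t) (+-identityʳ u) (+-monoʳ-≤ u t≥0)

+-cancelˡ-≤ : ∀ {z s t} → z + s ≤ z + t → s ≤ t
+-cancelˡ-≤ {z} {s} {t} le = subst₂ _≤_ (cancel s) (cancel t) (+-monoʳ-≤ (- z) le)
  where
  cancel : ∀ w → - z + (z + w) ≡ w
  cancel w = solve 2 (λ z w → (:- z) :+ (z :+ w) := w) refl z w

*-nonneg : ∀ {s t} → 0ℚ ≤ s → 0ℚ ≤ t → 0ℚ ≤ s * t
*-nonneg {s} {t} s≥0 t≥0 =
  subst (_≤ s * t) (*-zeroʳ s) (*-monoˡ-≤-nonNeg s {{nonNegative s≥0}} t≥0)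

*-pos : ∀ {s t} → 0ℚ < s → 0ℚ < t → 0ℚ < s * t
*-pos {s} {t} s>0 t>0 =
  subst (_< s * t) (*-zeroʳ s) (*-monoʳ-<-pos s {{positive s>0}} t>0)

square-mono : ∀ {s t} → 0ℚ ≤ s → s ≤ t → s * s ≤ t * t
square-mono {s} {t} s≥0 s≤t =
  ≤-trans (*-monoˡ-≤-nonNeg s {{nonNegative s≥0}} s≤t)
          (*-monoʳ-≤-nonNeg t {{nonNegative (≤-trans s≥0 s≤t)}} s≤t)

-- If u² ≥ q and w² ≥ q with u, w ≥ 0 then uw ≥ q: compare with the square of the smaller one.
square-bound-product : ∀ {u w q} → 0ℚ ≤ u → 0ℚ ≤ w → q ≤ u * u → q ≤ w * w → q ≤ u * w
square-bound-product {u} {w} u≥0 w≥0 q≤uu q≤ww with ≤-total u w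
... | inj₁ u≤w = ≤-trans q≤uu (*-monoˡ-≤-nonNeg u {{nonNegative u≥0}} u≤w)
... | inj₂ w≤u = ≤-trans q≤ww (*-monoʳ-≤-nonNeg w {{nonNegative w≥0}} w≤u)

√≤ᵇ-sound : ∀ {q x} → T (√ q ≤ᵇ x) → 0ℚ ≤ x × q ≤ x * x
√≤ᵇ-sound = Product.map ≤ᵇ⇒≤ ≤ᵇ⇒≤ ∘ Equivalence.to T-∧

𝟙 : Bool → ℚ
𝟙 true  = 1ℚ
𝟙 false = 0ℚ

𝟙-nonneg : ∀ b → 0ℚ ≤ 𝟙 b
𝟙-nonneg true  = *≤* (ℤ.+≤+ ℕ.z≤n)
𝟙-nonneg false = ≤-refl

_↾_ : ∀ {A : Set} → (A → ℚ) → (A → Bool) → A → ℚ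
(y ↾ p) x = if p x then y x else 0ℚ

∑ : ∀ {A : Set} → List A → (A → ℚ) → ℚ
∑ []       f = 0ℚ
∑ (x ∷ xs) f = f x + ∑ xs f

module _ {A : Set} where

  ∑-cong : ∀ (xs : List A) {f g : A → ℚ} → (∀ x → f x ≡ g x) → ∑ xs f ≡ ∑ xs g
  ∑-cong []       f≡g = refl
  ∑-cong (x ∷ xs) f≡g = cong₂ _+_ (f≡g x) (∑-cong xs f≡g)

  ∑-mono : ∀ (xs : List A) {f g : A → ℚ} → (∀ x → f x ≤ g x) → ∑ xs f ≤ ∑ xs g
  ∑-mono []       f≤g = ≤-refl
  ∑-mono (x ∷ xs) f≤g = +-mono-≤ (f≤g x) (∑-mono xs f≤g)

  ∑-nonneg : ∀ (xs : List A) {f : A → ℚ} → (∀ x → 0ℚ ≤ f x) → 0ℚ ≤ ∑ xs f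
  ∑-nonneg []       f≥0 = ≤-refl
  ∑-nonneg (x ∷ xs) f≥0 = +-mono-≤ (f≥0 x) (∑-nonneg xs f≥0)

  ∑-zero : ∀ (xs : List A) → ∑ xs (λ _ → 0ℚ) ≡ 0ℚ
  ∑-zero []       = refl
  ∑-zero (x ∷ xs) = trans (+-identityˡ _) (∑-zero xs)

  ∑-+ : ∀ (xs : List A) (f g : A → ℚ) → ∑ xs (λ x → f x + g x) ≡ ∑ xs f + ∑ xs g
  ∑-+ []       f g = refl
  ∑-+ (x ∷ xs) f g = trans (cong (_+_ (f x + g x)) (∑-+ xs f g))
    (solve 4 (λ a b c d → (a :+ b) :+ (c :+ d) := (a :+ c) :+ (b :+ d)) refl
           (f x) (g x) (∑ xs f) (∑ xs g))

  ∑-*ˡ : ∀ (xs : List A) (f : A → ℚ) t → t * ∑ xs f ≡ ∑ xs (λ x → t * f x)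
  ∑-*ˡ []       f t = *-zeroʳ t
  ∑-*ˡ (x ∷ xs) f t = trans (*-distribˡ-+ t (f x) (∑ xs f)) (cong (_+_ (t * f x)) (∑-*ˡ xs f t))

  ∑-*ʳ : ∀ (xs : List A) (f : A → ℚ) t → ∑ xs f * t ≡ ∑ xs (λ x → f x * t)
  ∑-*ʳ []       f t = *-zeroˡ t
  ∑-*ʳ (x ∷ xs) f t = trans (*-distribʳ-+ t (f x) (∑ xs f)) (cong (_+_ (f x * t)) (∑-*ʳ xs f t))

  ∑-const : ∀ (xs : List A) t → ∑ xs (λ _ → t) ≡ ℕ→ℚ (length xs) * t
  ∑-const []       t = sym (*-zeroˡ t)
  ∑-const (x ∷ xs) t = begin
    t + ∑ xs (λ _ → t)            ≡⟨ cong (_+_ t) (∑-const xs t) ⟩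
    t + ℕ→ℚ (length xs) * t       ≡⟨ solve 2 (λ t k → t :+ k :* t := (con 1ℚ :+ k) :* t) refl
                                             t (ℕ→ℚ (length xs)) ⟩
    (1ℚ + ℕ→ℚ (length xs)) * t    ≡⟨ cong (_* t) (sym (ℕ→ℚ-suc (length xs))) ⟩
    ℕ→ℚ (length (x ∷ xs)) * t     ∎
    where open ≡-Reasoning

  ∑-count : ∀ (p : A → Bool) (xs : List A) → ℕ→ℚ (length (filterᵇ p xs)) ≡ ∑ xs (𝟙 ∘ p)
  ∑-count p []       = refl
  ∑-count p (x ∷ xs) with p x
  ... | true  = trans (ℕ→ℚ-suc (length (filterᵇ p xs))) (cong (_+_ 1ℚ) (∑-count p xs))
  ... | false = trans (∑-count p xs) (sym (+-identityˡ _))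

  ∑-++ : ∀ (xs ys : List A) f → ∑ (xs ++ ys) f ≡ ∑ xs f + ∑ ys f
  ∑-++ []       ys f = sym (+-identityˡ _)
  ∑-++ (x ∷ xs) ys f = trans (cong (_+_ (f x)) (∑-++ xs ys f)) (sym (+-assoc (f x) _ _))

∑-map : ∀ {A B : Set} (g : A → B) (xs : List A) f → ∑ (map g xs) f ≡ ∑ xs (f ∘ g)
∑-map g []       f = refl
∑-map g (x ∷ xs) f = cong (_+_ (f (g x))) (∑-map g xs f)

∑-cartesianProduct : ∀ {A B : Set} (xs : List A) (ys : List B) f →
  ∑ (cartesianProduct xs ys) f ≡ ∑ xs (λ x → ∑ ys (λ y → f (x , y)))
∑-cartesianProduct []       ys f = refl
∑-cartesianProduct (x ∷ xs) ys f =
  trans (∑-++ (map (x ,_) ys) _ f) (cong₂ _+_ (∑-map (x ,_) ys f) (∑-cartesianProduct xs ys f))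

∑-swap : ∀ {A B : Set} (xs : List A) (ys : List B) (f : A → B → ℚ) →
  ∑ xs (λ x → ∑ ys (f x)) ≡ ∑ ys (λ y → ∑ xs (λ x → f x y))
∑-swap []       ys f = sym (∑-zero ys)
∑-swap (x ∷ xs) ys f =
  trans (cong (_+_ (∑ ys (f x))) (∑-swap xs ys f)) (sym (∑-+ ys (f x) (λ y → ∑ xs (λ x′ → f x′ y))))

∑-product : ∀ {A B : Set} (xs : List A) (ys : List B) f g →
  ∑ xs f * ∑ ys g ≡ ∑ xs (λ x → ∑ ys (λ y → f x * g y))
∑-product xs ys f g = trans (∑-*ʳ xs f (∑ ys g)) (∑-cong xs (λ x → ∑-*ˡ ys g (f x)))

-- An adjacent pair {i, j} is counted by the edge filter
-- at most once among (i, j) and (j, i), since i < j and j < i exclude each other, and it is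
-- counted once in the degree of i.

exclusive-bound : ∀ b b′ a → (T b → T b′ → ⊥) → 𝟙 (b ∧ a) + 𝟙 (b′ ∧ a) ≤ 𝟙 a
exclusive-bound true  true  a excl = ⊥-elim (excl _ _)
exclusive-bound true  false a _    = ≤-reflexive (+-identityʳ (𝟙 a))
exclusive-bound false true  a _    = ≤-reflexive (+-identityˡ (𝟙 a))
exclusive-bound false false a _    = 𝟙-nonneg a

handshake : ∀ {n} (G : Graph n) →
  ℕ→ℚ (edgeCount G) + ℕ→ℚ (edgeCount G) ≤ ∑ (allFin n) (λ v → ℕ→ℚ (degree G v))
handshake {n} G = begin
  E + E                                              ≡⟨ cong₂ _+_ E≡ (trans E≡ (sym (∑-swap V V F′))) ⟩
  ∑ V (λ i → ∑ V (F i)) + ∑ V (λ i → ∑ V (F′ i))     ≡⟨ sym (∑-+ V _ _) ⟩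
  ∑ V (λ i → ∑ V (F i) + ∑ V (F′ i))                 ≡⟨ ∑-cong V (λ i → sym (∑-+ V (F i) (F′ i))) ⟩
  ∑ V (λ i → ∑ V (λ j → F i j + F j i))              ≤⟨ ∑-mono V (λ i → ∑-mono V (pair-bound i)) ⟩
  ∑ V (λ i → ∑ V (λ j → 𝟙 (adj G i j)))              ≡⟨ ∑-cong V (λ i → sym (∑-count (adj G i) V)) ⟩
  ∑ V (λ v → ℕ→ℚ (degree G v))                       ∎
  where
  open ≤-Reasoning
  V : List (Fin n)
  V = allFin n
  E : ℚ
  E = ℕ→ℚ (edgeCount G)
  F : Fin n → Fin n → ℚ
  F i j = 𝟙 ((toℕ i ℕ.<ᵇ toℕ j) ∧ adj G i j)
  F′ : Fin n → Fin n → ℚ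
  F′ i j = F j i
  E≡ : E ≡ ∑ V (λ i → ∑ V (F i))
  E≡ = trans (∑-count _ (cartesianProduct V V)) (∑-cartesianProduct V V _)
  pair-bound : ∀ i j → F i j + F j i ≤ 𝟙 (adj G i j)
  pair-bound i j rewrite Graph.sym G j i =
    exclusive-bound (toℕ i ℕ.<ᵇ toℕ j) (toℕ j ℕ.<ᵇ toℕ i) (adj G i j)
      (λ i<j j<i → ℕ.<-asym (ℕ.<ᵇ⇒< (toℕ i) (toℕ j) i<j) (ℕ.<ᵇ⇒< (toℕ j) (toℕ i) j<i))

threshold-bound : ∀ {d t N} → d ≤ N → 0ℚ ≤ t → d ≤ t + 𝟙 (t ≤ᵇ d) * N
threshold-bound {d} {t} {N} d≤N t≥0 with t ≤ᵇ d in t≤ᵇd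
... | true  = ≤-trans d≤N (subst (_≤ t + 1ℚ * N) (trans (+-identityˡ _) (*-identityˡ N))
                              (+-monoˡ-≤ (1ℚ * N) t≥0))
... | false = subst (d ≤_) (sym (trans (cong (_+_ t) (*-zeroˡ N)) (+-identityʳ t)))
                (<⇒≤ (≰⇒> (λ t≤d → subst T t≤ᵇd (≤⇒≤ᵇ t≤d))))

raise-bound : ∀ b {d t B} → d ≤ B → t ≤ B → d + (if b then t - d else 0ℚ) ≤ B
raise-bound true  {d} {t} d≤B t≤B =
  subst (_≤ _) (solve 2 (λ d t → t := d :+ (t :- d)) refl d t) t≤B
raise-bound false {d}     d≤B t≤B = subst (_≤ _) (sym (+-identityʳ d)) d≤B

-- Square-count bound, the root-free form of "each selected weight is ≥ √q, so there are at
-- most (Σ weights)/√q of them": q·(#selected)² ≤ (Σ selected weights)².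

selected-product : ∀ b c {u w q} → (T b → 0ℚ ≤ u × q ≤ u * u) → (T c → 0ℚ ≤ w × q ≤ w * w) →
  (𝟙 b * 𝟙 c) * q ≤ (if b then u else 0ℚ) * (if c then w else 0ℚ)
selected-product true  true  {u} {w} {q} hu hw =
  subst (_≤ u * w) (sym (*-identityˡ q))
    (square-bound-product (proj₁ (hu _)) (proj₁ (hw _)) (proj₂ (hu _)) (proj₂ (hw _)))
selected-product true  false {u} {w} {q} _ _ = ≤-reflexive (trans (*-zeroˡ q) (sym (*-zeroʳ u)))
selected-product false true  {u} {w} {q} _ _ = ≤-reflexive (trans (*-zeroˡ q) (sym (*-zeroˡ w)))
selected-product false false {u} {w} {q} _ _ = ≤-reflexive (*-zeroˡ q)

square-count-bound : ∀ {A : Set} (xs : List A) (p : A → Bool) (y : A → ℚ) {q} →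
  (∀ x → T (p x) → 0ℚ ≤ y x × q ≤ y x * y x) →
  (∑ xs (𝟙 ∘ p) * ∑ xs (𝟙 ∘ p)) * q ≤ ∑ xs (y ↾ p) * ∑ xs (y ↾ p)
square-count-bound xs p y {q} sel = begin
  (∑ xs (𝟙 ∘ p) * ∑ xs (𝟙 ∘ p)) * q                    ≡⟨ cong (_* q) (∑-product xs xs _ _) ⟩
  ∑ xs (λ v → ∑ xs (λ w → 𝟙 (p v) * 𝟙 (p w))) * q      ≡⟨ ∑-*ʳ xs _ q ⟩
  ∑ xs (λ v → ∑ xs (λ w → 𝟙 (p v) * 𝟙 (p w)) * q)      ≡⟨ ∑-cong xs (λ v → ∑-*ʳ xs _ q) ⟩
  ∑ xs (λ v → ∑ xs (λ w → (𝟙 (p v) * 𝟙 (p w)) * q))    ≤⟨ ∑-mono xs (λ v → ∑-mono xs (λ w →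
                                                           selected-product (p v) (p w) (sel v) (sel w))) ⟩
  ∑ xs (λ v → ∑ xs (λ w → (y ↾ p) v * (y ↾ p) w))      ≡⟨ sym (∑-product xs xs _ _) ⟩
  ∑ xs (y ↾ p) * ∑ xs (y ↾ p)                          ∎
  where open ≤-Reasoning

∑-restrict-nonneg : ∀ {A : Set} (xs : List A) (p : A → Bool) (y : A → ℚ) →
  (∀ x → T (p x) → 0ℚ ≤ y x) → 0ℚ ≤ ∑ xs (y ↾ p)
∑-restrict-nonneg xs p y sel = ∑-nonneg xs nonneg
  where
  nonneg : ∀ x → 0ℚ ≤ (y ↾ p) x
  nonneg x with p x | sel x
  ... | true  | y≥0 = y≥0 _
  ... | false | _   = ≤-refl

module DegreeProfile (n : ℕ) (G : Graph n) (δ : ℚ) where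

  V : List (Fin n)
  V = allFin n

  N : ℚ
  N = ℕ→ℚ n

  d : Fin n → ℚ
  d v = ℕ→ℚ (degree G v)

  a : ℚ
  a = (+ 2 / 5) + δ

  high : Fin n → Bool
  high v = a * N ≤ᵇ d v

  -- q = 4δN² = (2√δ·N)², the deficit x(v) = (2/5)N - d(v), and the low vertices x(v) ≥ √q
  q : ℚ
  q = (+ 4 / 1) * δ * (N * N)

  deficit : Fin n → ℚ
  deficit v = (+ 2 / 5) * N - d v

  low : Fin n → Bool
  low v = √ q ≤ᵇ deficit v

  H L : ℚ
  H = ℕ→ℚ (countV high)
  L = ℕ→ℚ (countV low)

  S : ℚ
  S = ∑ V (deficit ↾ low)

  degree≤N : ∀ v → d v ≤ N
  degree≤N v = ℕ→ℚ-mono (degree G v) n (subst (degree G v ℕ.≤_) (List.length-tabulate (λ i → i))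
                                (List.length-filter (T? ∘ adj G v) V))

  vertex-bound : 0ℚ ≤ δ → ∀ v → d v + (deficit ↾ low) v ≤ a * N + 𝟙 (high v) * N
  vertex-bound δ≥0 v = raise-bound (low v) {d v} {(+ 2 / 5) * N} high-bound target-bound
    where
    N≥0 : 0ℚ ≤ N
    N≥0 = ℕ→ℚ-nonneg n
    a≥0 : 0ℚ ≤ a
    a≥0 = +-mono-≤ {0ℚ} {+ 2 / 5} {0ℚ} {δ} (*≤* (ℤ.+≤+ ℕ.z≤n)) δ≥0
    high-bound : d v ≤ a * N + 𝟙 (high v) * N
    high-bound = threshold-bound (degree≤N v) (*-nonneg a≥0 N≥0)
    target-bound : (+ 2 / 5) * N ≤ a * N + 𝟙 (high v) * N
    target-bound = ≤-trans (*-monoʳ-≤-nonNeg N {{nonNegative N≥0}} (≤-+-nonneg {+ 2 / 5} δ≥0))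
                           (≤-+-nonneg {a * N} (*-nonneg (𝟙-nonneg (high v)) N≥0))

  degree-sum-bound : 0ℚ ≤ δ → ∑ V d + S ≤ N * (a * N) + H * N
  degree-sum-bound δ≥0 = begin
    ∑ V d + S                                 ≡⟨ sym (∑-+ V d (deficit ↾ low)) ⟩
    ∑ V (λ v → d v + (deficit ↾ low) v)       ≤⟨ ∑-mono V (vertex-bound δ≥0) ⟩
    ∑ V (λ v → a * N + 𝟙 (high v) * N)        ≡⟨ ∑-+ V _ _ ⟩
    ∑ V (λ _ → a * N) + ∑ V (λ v → 𝟙 (high v) * N)
      ≡⟨ cong₂ _+_ (trans (∑-const V (a * N)) (cong (λ k → ℕ→ℚ k * (a * N)) (List.length-tabulate {n = n} (λ i → i))))
                   (trans (sym (∑-*ʳ V _ N)) (cong (_* N) (sym (∑-count high V)))) ⟩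
    N * (a * N) + H * N                       ∎
    where open ≤-Reasoning

  deficit-bound : 0ℚ ≤ δ → ((+ 1 / 5) - δ) * (N * N) ≤ ℕ→ℚ (edgeCount G) → H ≤ δ * N → S ≤ q
  deficit-bound δ≥0 many-edges few-high = +-cancelˡ-≤ {X + X} (begin
    (X + X) + S                          ≤⟨ +-monoˡ-≤ S (+-mono-≤ many-edges many-edges) ⟩
    (E + E) + S                          ≤⟨ +-monoˡ-≤ S (handshake G) ⟩
    ∑ V d + S                            ≤⟨ degree-sum-bound δ≥0 ⟩
    N * (a * N) + H * N                  ≤⟨ +-monoʳ-≤ (N * (a * N)) (*-monoʳ-≤-nonNeg N {{nonNegative (ℕ→ℚ-nonneg n)}} few-high) ⟩
    N * (a * N) + δ * N * N              ≡⟨ solve 3 (λ t δ N → N :* ((t :+ t :+ δ) :* N) :+ δ :* N :* N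
                                                := ((t :- δ) :* (N :* N) :+ (t :- δ) :* (N :* N))
                                                   :+ (con 1ℚ :+ con 1ℚ :+ con 1ℚ :+ con 1ℚ) :* δ :* (N :* N))
                                                refl (+ 1 / 5) δ N ⟩
    (X + X) + q                          ∎)
    where
    open ≤-Reasoning
    X E : ℚ
    X = ((+ 1 / 5) - δ) * (N * N)
    E = ℕ→ℚ (edgeCount G)

  low-count-bound : 0ℚ < q → S ≤ q → L * L ≤ q
  low-count-bound q>0 S≤q = *-cancelʳ-≤-pos q {{positive q>0}} (begin
    (L * L) * q     ≡⟨ cong (λ l → (l * l) * q) (∑-count low V) ⟩
    (ℓ * ℓ) * q     ≤⟨ square-count-bound V low deficit (λ v → √≤ᵇ-sound {q} {deficit v}) ⟩
    S * S           ≤⟨ square-mono S≥0 S≤q ⟩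
    q * q           ∎)
    where
    open ≤-Reasoning
    ℓ : ℚ
    ℓ = ∑ V (𝟙 ∘ low)
    S≥0 : 0ℚ ≤ S
    S≥0 = ∑-restrict-nonneg V low deficit (λ v → proj₁ ∘ √≤ᵇ-sound {q} {deficit v})

  dichotomy : 0ℚ < N → 0ℚ < δ → ((+ 1 / 5) - δ) * (N * N) ≤ ℕ→ℚ (edgeCount G) →
              δ * N ≤ H ⊎ L ≤√ q
  dichotomy N>0 δ>0 many-edges = by-cases (δ * N ≤? H)
    where
    q>0 : 0ℚ < q
    q>0 = *-pos (*-pos (ℕ→ℚ-pos 3) δ>0) (*-pos N>0 N>0)
    by-cases : Dec (δ * N ≤ H) → δ * N ≤ H ⊎ L ≤√ q
    by-cases (yes many-high) = inj₁ many-high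
    by-cases (no few-high)   =
      inj₂ (inj₂ (low-count-bound q>0 (deficit-bound (<⇒≤ δ>0) many-edges (<⇒≤ (≰⇒> few-high)))))

lemma5p3 : (n : ℕ) (G : Graph n) (δ : ℚ) → 0ℚ < δ
    → ((+ 1 / 5) - δ) * (ℕ→ℚ n * ℕ→ℚ n) ≤ ℕ→ℚ (edgeCount G)
    → (δ * ℕ→ℚ n ≤ ℕ→ℚ (countV (λ v → ((+ 2 / 5) + δ) * ℕ→ℚ n ≤ᵇ ℕ→ℚ (degree G v))))
      ⊎ (ℕ→ℚ (countV (λ v → √ ((+ 4 / 1) * δ * (ℕ→ℚ n * ℕ→ℚ n)) ≤ᵇ ((+ 2 / 5) * ℕ→ℚ n - ℕ→ℚ (degree G v))))
          ≤√ ((+ 4 / 1) * δ * (ℕ→ℚ n * ℕ→ℚ n)))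
-- With no vertices there are no low vertices.
lemma5p3 zero    G δ δ>0 many-edges = inj₂ (inj₁ ≤-refl)
lemma5p3 (suc m) G δ δ>0 many-edges = DegreeProfile.dichotomy (suc m) G δ (ℕ→ℚ-pos m) δ>0 many-edges
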